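{- A universe $\mathcal U$ is univalent if and only if, for all $A,B:\mathcal U$ and $f:A\to B$, there is a map $\operatorname{isEquiv}(f)\to\operatorname{isPIE}_{A,B}(f)$.
   Context: Martin-Löf type theory with a universe $\mathcal U$ (no extensionality axioms assumed). $\operatorname{idtofun}:(A=B)\to(A\to B)$ is defined by path induction with $\operatorname{idtofun}(\mathrm{refl}_A)=\mathrm{id}_A$, and $\operatorname{idtoequiv}:(A=B)\to(A\simeq B)$ similarly. $\operatorname{isEquiv}(f):=\big(\sum_{g:B\to A}g\circ f\sim\mathrm{id}_A\big)\times\big(\sum_{h:B\to A}f\circ h\sim\mathrm{id}_B\big)$, where $\sim$ is pointwise equality, and $A\simeq B:=\sum_{f:A\to B}\operatorname{isEquiv}(f)$. A path-induced equivalence structure on $f:A\to B$ is $\operatorname{isPIE}_{A,B}(f):=\sum_{p:A=B}f=\operatorname{idtofun}(p)$. $\mathcal U$ is univalent if $\operatorname{idtoequiv}_{A,B}$ is an equivalence for all $A,B:\mathcal U$. -}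

{-# OPTIONS --without-K #-}
module Defs where

open import Level using (Level; _⊔_; suc)
open import Data.Product using (Σ; _×_; _,_; proj₁)
open import Relation.Binary.PropositionalEquality using (_≡_; refl)

_∼_ : ∀ {a b} {A : Set a} {B : A → Set b} → (f g : (x : A) → B x) → Set (a ⊔ b)
f ∼ g = ∀ x → f x ≡ g x

isEquiv : ∀ {a b} {A : Set a} {B : Set b} → (A → B) → Set (a ⊔ b)
isEquiv {A = A} {B = B} f =
  (Σ (B → A) λ g → (λ x → g (f x)) ∼ (λ x → x))
  × (Σ (B → A) λ h → (λ y → f (h y)) ∼ (λ y → y))

_≃_ : ∀ {a b} → Set a → Set b → Set (a ⊔ b)
A ≃ B = Σ (A → B) isEquiv

idtofun : ∀ {ℓ} {A B : Set ℓ} → A ≡ B → A → B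
idtofun refl = λ x → x

idIsEquiv : ∀ {ℓ} (A : Set ℓ) → isEquiv (λ (x : A) → x)
idIsEquiv A = ((λ x → x) , λ x → refl) , ((λ x → x) , λ x → refl)

idtoequiv : ∀ {ℓ} {A B : Set ℓ} → A ≡ B → A ≃ B
idtoequiv {A = A} refl = (λ x → x) , idIsEquiv A

isPIE : ∀ {ℓ} (A B : Set ℓ) → (A → B) → Set (suc ℓ)
isPIE A B f = Σ (A ≡ B) λ p → f ≡ idtofun p

isUnivalent : (ℓ : Level) → Set (suc ℓ)
isUnivalent ℓ = (A B : Set ℓ) → isEquiv (idtoequiv {ℓ} {A} {B})

{-# OPTIONS --safe #-}
{-# OPTIONS --without-K #-}
module Submission where

-- Without function extensionality the crux of the converse is that isEquiv id is a
-- proposition. The endpoint map of the free path space Σ x y, y ≡ x is an equivalence,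
-- so the hypothesis makes it idtofun of a path; postcomposition with idtofun of a path has
-- propositional fibres by path induction, and the type of homotopies g ∼ id is a retract
-- of the fibre over id. Given that, the hypothesis yields a section of idtoequiv, and any
-- family of maps back into the based path space yields a retraction.

open import Defs
open import Level using (Level)
open import Data.Product using (Σ; _×_; _,_; proj₁; proj₂)
open import Relation.Binary.PropositionalEquality using (_≡_; refl; sym; trans; cong; cong-app)
open import Relation.Binary.PropositionalEquality.Properties using (trans-symˡ)
open import Relation.Nullary using (Irrelevant)

module _ {ℓ : Level} where

  PIE-from-equiv : Set (Level.suc ℓ)
  PIE-from-equiv = (A B : Set ℓ) (f : A → B) → isEquiv f → isPIE A B f

  idtoequiv-fun : {A B : Set ℓ} (p : A ≡ B) → proj₁ (idtoequiv p) ≡ idtofun p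
  idtoequiv-fun refl = refl

  section-of-idtoequiv⇒PIE-from-equiv :
    (s : {A B : Set ℓ} → A ≃ B → A ≡ B) → ({A B : Set ℓ} (e : A ≃ B) → idtoequiv (s e) ≡ e) →
    PIE-from-equiv
  section-of-idtoequiv⇒PIE-from-equiv s idtoequiv∘s A B f e =
    s (f , e) , trans (sym (cong proj₁ (idtoequiv∘s (f , e)))) (idtoequiv-fun (s (f , e)))

  postcomp-fibre-irrelevant : {A X Y : Set ℓ} {f : X → Y} → isPIE X Y f → (m : A → Y) →
                              Irrelevant (Σ (A → X) λ k → (λ x → f (k x)) ≡ m)
  postcomp-fibre-irrelevant (refl , refl) m (k , refl) (k′ , refl) = refl

  FreePaths : Set ℓ → Set ℓ
  FreePaths A = Σ A λ x → Σ A λ y → y ≡ x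

  endpoint : {A : Set ℓ} → FreePaths A → A
  endpoint = proj₁

  constant-path : {A : Set ℓ} → A → FreePaths A
  constant-path x = x , x , refl

  endpoint-isEquiv : (A : Set ℓ) → isEquiv (endpoint {A})
  endpoint-isEquiv A = (constant-path , λ { (x , y , refl) → refl }) , (constant-path , λ x → refl)

  HomotopicToId : Set ℓ → Set ℓ
  HomotopicToId A = Σ (A → A) λ g → (λ x → g x) ∼ (λ x → x)

  EndpointFibre : Set ℓ → Set ℓ
  EndpointFibre A = Σ (A → FreePaths A) λ k → (λ x → endpoint (k x)) ≡ (λ x → x)

  toEndpointFibre : {A : Set ℓ} → HomotopicToId A → EndpointFibre A
  toEndpointFibre (g , η) = (λ x → x , g x , η x) , refl

  -- Unlike stdlib's trans, this one computes on its second argument, which makes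
  -- fromEndpointFibre ∘ toEndpointFibre the identity definitionally.
  private
    trans′ : {A : Set ℓ} {x y z : A} → x ≡ y → y ≡ z → x ≡ z
    trans′ p refl = p

  fromEndpointFibre : {A : Set ℓ} → EndpointFibre A → HomotopicToId A
  fromEndpointFibre (k , α) = (λ x → proj₁ (proj₂ (k x))) , λ x → trans′ (proj₂ (proj₂ (k x))) (cong-app α x)

  HomotopicToId-irrelevant : PIE-from-equiv → (A : Set ℓ) → Irrelevant (HomotopicToId A)
  HomotopicToId-irrelevant E A h h′ =
    cong fromEndpointFibre
      (postcomp-fibre-irrelevant (E (FreePaths A) A endpoint (endpoint-isEquiv A)) (λ x → x)
        (toEndpointFibre h) (toEndpointFibre h′))

  isEquiv-id-irrelevant : PIE-from-equiv → (A : Set ℓ) → Irrelevant (isEquiv (λ (x : A) → x))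
  isEquiv-id-irrelevant E A (r , s) (r′ , s′)
    with HomotopicToId-irrelevant E A r r′ | HomotopicToId-irrelevant E A s s′
  ... | refl | refl = refl

  idtoequiv-of-PIE : PIE-from-equiv → {A B : Set ℓ} {f : A → B} (π : isPIE A B f) (e : isEquiv f) →
                       idtoequiv (proj₁ π) ≡ (f , e)
  idtoequiv-of-PIE E (refl , refl) e = cong ((λ x → x) ,_) (isEquiv-id-irrelevant E _ (idIsEquiv _) e)

  retraction-of-based-paths :
    {A : Set ℓ} {P : Set ℓ → Set ℓ} (φ : {B : Set ℓ} → A ≡ B → P B) (r : {B : Set ℓ} → P B → A ≡ B) →
    {B : Set ℓ} (p : A ≡ B) → trans (sym (r (φ refl))) (r (φ p)) ≡ p
  retraction-of-based-paths φ r refl = trans-symˡ (r (φ refl))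

  PIE-from-equiv⇒isUnivalent : PIE-from-equiv → isUnivalent ℓ
  PIE-from-equiv⇒isUnivalent E A B =
    ((λ e → trans (sym (s (idtoequiv {A = A} refl))) (s e)) , retraction-of-based-paths idtoequiv s) ,
    (s , λ (f , e) → idtoequiv-of-PIE E (E A B f e) e)
    where
      s : {X Y : Set ℓ} → X ≃ Y → X ≡ Y
      s {X} {Y} (f , e) = proj₁ (E X Y f e)

theorem2p45 : (ℓ : Level) → (isUnivalent ℓ → ((A B : Set ℓ) (f : A → B) → isEquiv f → isPIE A B f)) × (((A B : Set ℓ) (f : A → B) → isEquiv f → isPIE A B f) → isUnivalent ℓ)
theorem2p45 ℓ =
  (λ U → section-of-idtoequiv⇒PIE-from-equiv
           (λ {A} {B} → proj₁ (proj₂ (U A B))) (λ {A} {B} → proj₂ (proj₂ (U A B)))) ,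
  PIE-from-equiv⇒isUnivalent
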